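{- Let $n\ge 2$ and $k\in\{n-1,n\}$, and let $M_k$ be a matching of $k$ edges in the complete graph $K_{2n}$. Then $\chi'_L(K_{2n}\setminus M_k)=2n$.
   Context: $K_{2n}\setminus M_k$ denotes the graph obtained from $K_{2n}$ by deleting the edges of $M_k$. For a proper edge coloring $c:E(G)\to\{1,\dots,k\}$ of a connected graph $G$, let $\pi=(\mathcal{C}_1,\dots,\mathcal{C}_k)$ be the ordered partition of $E(G)$ into color classes. For a vertex $v$ and an edge $e=xy$, $d(v,e)=\min\{d(v,x),d(v,y)\}$, and $d(v,\mathcal{C}_i)=\min\{d(v,e): e\in\mathcal{C}_i\}$. The edge color code of $v$ is $c_\pi(v)=(d(v,\mathcal{C}_1),\dots,d(v,\mathcal{C}_k))$. The coloring is an edge-locating coloring if distinct vertices have distinct edge color codes; $\chi'_L(G)$ is the minimum number of colors in an edge-locating coloring of $G$. -}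

module Defs where

open import Data.Nat using (ℕ; zero; suc; _≤_; _⊓_; _*_; _∸_)
open import Data.Fin using (Fin)
open import Data.Product using (Σ; ∃; ∃-syntax; _×_; _,_)
open import Data.Sum using (_⊎_)
open import Function.Definitions using (Injective)
open import Relation.Binary.PropositionalEquality using (_≡_; _≢_)
open import Relation.Nullary using (¬_)

-- A simple graph on the vertex set Fin N, given by its adjacency relation.
-- (All graphs used below are symmetric and irreflexive by construction.)
Graph : ℕ → Set₁
Graph N = Fin N → Fin N → Set

data Walk {N : ℕ} (G : Graph N) : Fin N → Fin N → ℕ → Set where
  here : ∀ {u} → Walk G u u zero
  step : ∀ {u v w ℓ} → G u v → Walk G v w ℓ → Walk G u w (suc ℓ)

Dist : ∀ {N} → Graph N → Fin N → Fin N → ℕ → Set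
Dist G u v d = Walk G u v d × (∀ ℓ → Walk G u v ℓ → d ≤ ℓ)

K : (N : ℕ) → Graph N
K N x y = x ≢ y

-- A matching of k edges in K_N: edges {m₁ i, m₂ i}, i : Fin k, whose 2k
-- endpoints are pairwise distinct.
record Matching (N k : ℕ) : Set where
  field
    end : Fin k ⊎ Fin k → Fin N
    end-injective : Injective _≡_ _≡_ end

InMatching : ∀ {N k} → Matching N k → Fin N → Fin N → Set
InMatching {k = k} M x y =
  ∃[ i ] ((x ≡ Matching.end M (Data.Sum.inj₁ i) × y ≡ Matching.end M (Data.Sum.inj₂ i))
         ⊎ (x ≡ Matching.end M (Data.Sum.inj₂ i) × y ≡ Matching.end M (Data.Sum.inj₁ i)))

KminusM : ∀ {N k} → Matching N k → Graph N
KminusM M x y = K _ x y × ¬ InMatching M x y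

-- A proper edge coloring with colors Fin m.  The color of the edge xy is
-- col x y (the values on non-edges are irrelevant).
record ProperEdgeColoring {N : ℕ} (G : Graph N) (m : ℕ) : Set where
  field
    col    : Fin N → Fin N → Fin m
    col-sym : ∀ x y → G x y → col x y ≡ col y x
    proper : ∀ x y z → G x y → G x z → y ≢ z → col x y ≢ col x z

module _ {N : ℕ} {G : Graph N} {m : ℕ} (c : ProperEdgeColoring G m) where
  open ProperEdgeColoring c

  EdgeDist : Fin N → Fin N → Fin N → ℕ → Set
  EdgeDist v x y d = ∃[ dx ] ∃[ dy ] (Dist G v x dx × Dist G v y dy × d ≡ dx ⊓ dy)

  ClassDist : Fin N → Fin m → ℕ → Set
  ClassDist v i d =
    (∃[ x ] ∃[ y ] (G x y × col x y ≡ i × EdgeDist v x y d))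
    × (∀ x y d' → G x y → col x y ≡ i → EdgeDist v x y d' → d ≤ d')

  IsEdgeLocating : Set
  IsEdgeLocating = ∀ u w → u ≢ w →
    ∃[ i ] ∃[ d ] ∃[ d' ] (ClassDist u i d × ClassDist w i d' × d ≢ d')

EdgeLocatingChromaticIndex : ∀ {N} → Graph N → ℕ → Set
EdgeLocatingChromaticIndex G χ =
  (Σ (ProperEdgeColoring G χ) IsEdgeLocating)
  × (∀ m → (c : ProperEdgeColoring G m) → IsEdgeLocating c → χ ≤ m)

module Submission where

-- In K₂ₙ minus a matching, a vertex off an edge is adjacent to one of its ends, so the
-- distance from v to a colour class is 0 or 1 according as v sees that colour or not:
-- a proper colouring is edge-locating exactly when distinct vertices see distinct sets
-- of colours.  With m < 2n colours this fails: a vertex of degree at least m sees all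
-- colours, there are two such vertices when the matching misses two vertices, and for a
-- perfect matching with m = 2n − 1 every vertex misses exactly one colour, so two of
-- them miss the same one.  For 2n colours, label the vertices injectively by
-- 0, …, 2n − 1 and colour xy by (x + y) mod 2n; then x misses the even colour 2x and,
-- if matched to y, the odd colour x + y.  Labellings making these sets distinct exist
-- for odd and for even n ≥ 3; for n = 2 explicit colourings are checked by evaluation.

open import Defs
open import Data.Empty using (⊥-elim)
open import Data.Fin using (Fin; zero; suc; toℕ; fromℕ<; punchIn; punchOut; splitAt; join; #_)
import Data.Fin.Properties as Finₚ
open import Data.Maybe using (Maybe; nothing; just)
import Data.Maybe.Properties as Maybeₚ
open import Data.Nat using (ℕ; zero; suc; _+_; _*_; _∸_; _%_; _≤_; _<_; _⊓_; z≤n; s≤s; s≤s⁻¹; NonZero)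
open import Data.Nat.Divisibility using (m∣m*n)
open import Data.Nat.DivMod
  using ( m<n⇒m%n≡m; m≤n⇒[n∸m]%m≡n%m; m%n<n; m%n%n≡m%n; m∣n⇒o%n%m≡o%m
        ; m*n%n≡0; [m+kn]%n≡m%n; %-distribˡ-+)
open import Data.Nat.Properties
open import Data.Nat.Solver using (module +-*-Solver)
open import Data.Product using (∃; ∃₂; _×_; _,_; proj₁; proj₂; uncurry; map₂)
open import Data.Sum using (_⊎_; inj₁; inj₂; swap; reduce)
import Data.Sum.Properties as Sumₚ
open import Data.Vec.Functional using (_∷_)
open import Function.Base using (_∘_; case_of_)
open import Function.Bundles using (_⇔_; mk⇔; Equivalence; _↔_; Inverse; mk↔ₛ′)
open import Function.Definitions using (Injective; StrictlySurjective)
open import Relation.Binary.PropositionalEquality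
open import Relation.Nullary using (¬_; Dec; yes; no; contradiction)
open import Relation.Nullary.Decidable
  using (_×-dec_; _⊎-dec_; _→-dec_; ¬?; map′; True; toWitness; decidable-stable)

2*n≡n+n : ∀ n → 2 * n ≡ n + n
2*n≡n+n n = cong (n +_) (+-identityʳ n)

injective⇒surjective : ∀ {p q} {f : Fin p → Fin q} →
  Injective _≡_ _≡_ f → q ≤ p → StrictlySurjective _≡_ f
injective⇒surjective {p} {suc q} {f} f-injective q<p y with Finₚ.any? (λ x → f x Finₚ.≟ y)
... | yes hit = hit
... | no miss = contradiction (Finₚ.injective⇒≤ avoid-injective) (<⇒≱ q<p)
  where
  y≢f : ∀ x → y ≢ f x
  y≢f x y≡fx = miss (x , sym y≡fx)

  avoid-injective : Injective _≡_ _≡_ (λ x → punchOut (y≢f x))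
  avoid-injective {x} {x′} = f-injective ∘ Finₚ.punchOut-injective (y≢f x) (y≢f x′)

injective⇒missing : ∀ {p q} {f : Fin p → Fin q} →
  Injective _≡_ _≡_ f → p < q → ∃ λ y → ∀ x → f x ≢ y
injective⇒missing {p} {q} {f} f-injective p<q =
  let y , unhit = Finₚ.¬∀⟶∃¬ q _ (λ y → Finₚ.any? λ x → f x Finₚ.≟ y) not-onto
  in y , λ x fx≡y → unhit (x , fx≡y)
  where
  not-onto : ¬ StrictlySurjective _≡_ f
  not-onto onto = <⇒≱ p<q (Finₚ.injective⇒≤ {f = proj₁ ∘ onto} section-injective)
    where
    section-injective : Injective _≡_ _≡_ (proj₁ ∘ onto)
    section-injective {y} {y′} eq = trans (sym (proj₂ (onto y))) (trans (cong f eq) (proj₂ (onto y′)))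

∷-injective : ∀ {p q} {f : Fin p → Fin q} {y : Fin q} →
  Injective _≡_ _≡_ f → (∀ x → f x ≢ y) → Injective _≡_ _≡_ (y ∷ f)
∷-injective f-injective f≢y {zero}  {zero}   _  = refl
∷-injective f-injective f≢y {zero}  {suc x′} eq = ⊥-elim (f≢y x′ (sym eq))
∷-injective f-injective f≢y {suc x} {zero}   eq = ⊥-elim (f≢y x eq)
∷-injective f-injective f≢y {suc x} {suc x′} eq = cong suc (f-injective eq)

injective⇒missesOne : ∀ {p} {f : Fin p → Fin (suc p)} → Injective _≡_ _≡_ f →
  ∃ λ y → (∀ x → f x ≢ y) × (∀ y′ → y′ ≢ y → ∃ λ x → f x ≡ y′)
injective⇒missesOne {f = f} f-injective with y , f≢y ← injective⇒missing f-injective ≤-refl = y , f≢y , hit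
  where
  hit : ∀ y′ → y′ ≢ y → ∃ λ x → f x ≡ y′
  hit y′ y′≢y with injective⇒surjective (∷-injective f-injective f≢y) ≤-refl y′
  ... | zero  , y≡y′  = contradiction (sym y≡y′) y′≢y
  ... | suc x , fx≡y′ = x , fx≡y′

injective⇒twoMissing : ∀ {p q} {f : Fin p → Fin q} → Injective _≡_ _≡_ f → suc p < q →
  ∃₂ λ y y′ → y ≢ y′ × (∀ x → f x ≢ y) × (∀ x → f x ≢ y′)
injective⇒twoMissing {p} f-injective 1+p<q =
  let y  , f≢y    = injective⇒missing f-injective (<-trans (n<1+n p) 1+p<q)
      y′ , y∷f≢y′ = injective⇒missing (∷-injective f-injective f≢y) 1+p<q
  in y , y′ , y∷f≢y′ zero , f≢y , y∷f≢y′ ∘ suc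

splitAt-injective : ∀ m {n} → Injective _≡_ _≡_ (splitAt m {n})
splitAt-injective m {n} {x} {y} eq =
  trans (sym (Finₚ.join-splitAt m n x)) (trans (cong (join m n) eq) (Finₚ.join-splitAt m n y))

⊎-injective⇒surjective : ∀ {n q} {f : Fin n ⊎ Fin n → Fin q} →
  Injective _≡_ _≡_ f → q ≤ 2 * n → StrictlySurjective _≡_ f
⊎-injective⇒surjective {n} {f = f} f-injective q≤2n y
  with x , fx≡y ← injective⇒surjective {f = f ∘ splitAt n} (splitAt-injective n ∘ f-injective)
                    (≤-trans q≤2n (≤-reflexive (2*n≡n+n n))) y
  = splitAt n x , fx≡y

avoid-both : ∀ {N} → 3 ≤ N → (a b : Fin N) → ∃ λ z → z ≢ a × z ≢ b
avoid-both {suc (suc (suc N))} (s≤s (s≤s (s≤s _))) a b with a Finₚ.≟ b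
... | yes refl = punchIn a zero , Finₚ.punchInᵢ≢i a zero , Finₚ.punchInᵢ≢i a zero
... | no a≢b   = punchIn a (punchIn b′ zero) , Finₚ.punchInᵢ≢i a _ , z≢b
  where
  b′ : Fin (suc (suc N))
  b′ = punchOut a≢b
  z≢b : punchIn a (punchIn b′ zero) ≢ b
  z≢b eq = Finₚ.punchInᵢ≢i b′ zero
    (Finₚ.punchIn-injective a _ _ (trans eq (sym (Finₚ.punchIn-punchOut a≢b))))

-- Distances in K_N minus a matching

module _ {N : ℕ} {G : Graph N} where

  walk-positive : ∀ {u v ℓ} → u ≢ v → Walk G u v ℓ → 1 ≤ ℓ
  walk-positive u≢v here       = contradiction refl u≢v
  walk-positive u≢v (step _ _) = s≤s z≤n

  walk-one : ∀ {u v} → Walk G u v 1 → G u v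
  walk-one (step uv here) = uv

  dist-self : ∀ v → Dist G v v 0
  dist-self v = here , λ _ _ → z≤n

  dist-positive : ∀ {u v d} → u ≢ v → Dist G u v d → 1 ≤ d
  dist-positive u≢v (w , _) = walk-positive u≢v w

  dist-adjacent : ∀ {u v} → u ≢ v → G u v → Dist G u v 1
  dist-adjacent u≢v uv = step uv here , λ _ → walk-positive u≢v

  dist-two : ∀ {u v w} → u ≢ v → ¬ G u v → G u w → G w v → Dist G u v 2
  dist-two {u} {v} u≢v ¬uv uw wv = step uw (step wv here) , shortest
    where
    shortest : ∀ ℓ → Walk G u v ℓ → 2 ≤ ℓ
    shortest zero          w = contradiction (walk-positive u≢v w) λ ()
    shortest (suc zero)    w = contradiction (walk-one w) ¬uv
    shortest (suc (suc _)) _ = s≤s (s≤s z≤n)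

  dist-unique : ∀ {u v d d′} → Dist G u v d → Dist G u v d′ → d ≡ d′
  dist-unique (w , shortest) (w′ , shortest′) = ≤-antisym (shortest _ w′) (shortest′ _ w)

module _ {N k : ℕ} (M : Matching N k) where
  open Matching M

  private
    G : Graph N
    G = KminusM M

  inMatching? : ∀ x y → Dec (InMatching M x y)
  inMatching? x y = Finₚ.any? λ i →
    (x Finₚ.≟ end (inj₁ i) ×-dec y Finₚ.≟ end (inj₂ i)) ⊎-dec
    (x Finₚ.≟ end (inj₂ i) ×-dec y Finₚ.≟ end (inj₁ i))

  inMatching-sym : ∀ {x y} → InMatching M x y → InMatching M y x
  inMatching-sym (i , inj₁ (x≡ , y≡)) = i , inj₂ (y≡ , x≡)
  inMatching-sym (i , inj₂ (x≡ , y≡)) = i , inj₁ (y≡ , x≡)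

  inMatching⇒ends : ∀ {x y} → InMatching M x y → ∃ λ s → x ≡ end s × y ≡ end (swap s)
  inMatching⇒ends (i , inj₁ (x≡ , y≡)) = inj₁ i , x≡ , y≡
  inMatching⇒ends (i , inj₂ (x≡ , y≡)) = inj₂ i , x≡ , y≡

  ends-matched : ∀ s → InMatching M (end s) (end (swap s))
  ends-matched (inj₁ i) = i , inj₁ (refl , refl)
  ends-matched (inj₂ i) = i , inj₂ (refl , refl)

  inMatching-functional : ∀ {v x y} → InMatching M v x → InMatching M v y → x ≡ y
  inMatching-functional vx vy
    with s , refl , refl ← inMatching⇒ends vx | s′ , ends≡ , refl ← inMatching⇒ends vy
    = cong (end ∘ swap) (end-injective ends≡)

  inMatching-irreflexive : ∀ {x} → ¬ InMatching M x x
  inMatching-irreflexive xx with s , refl , ends≡ ← inMatching⇒ends xx = swap-fixpoint-free s (end-injective ends≡)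
    where
    swap-fixpoint-free : ∀ (s : Fin k ⊎ Fin k) → s ≢ swap s
    swap-fixpoint-free (inj₁ _) ()
    swap-fixpoint-free (inj₂ _) ()

  uncovered⇒unmatched : ∀ {v} → (∀ s → end s ≢ v) → ∀ y → ¬ InMatching M v y
  uncovered⇒unmatched uncovered y vy = let s , v≡ , _ = inMatching⇒ends vy in uncovered s (sym v≡)

  perfect⇒allMatched : N ≤ 2 * k → ∀ v → ∃ (InMatching M v)
  perfect⇒allMatched N≤2k v with s , refl ← ⊎-injective⇒surjective end-injective N≤2k v = _ , ends-matched s

  nearPerfect⇒twoUncovered : 2 * suc k ≤ N →
    ∃₂ λ u w → u ≢ w × (∀ s → end s ≢ u) × (∀ s → end s ≢ w)
  nearPerfect⇒twoUncovered 2k+2≤N =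
    let u , w , u≢w , ∉u , ∉w = injective⇒twoMissing (splitAt-injective k ∘ end-injective) 2+k+k≤N
    in u , w , u≢w , uncovered ∉u , uncovered ∉w
    where
    2+k+k≤N : suc (suc (k + k)) ≤ N
    2+k+k≤N = ≤-trans (≤-reflexive (sym (trans (*-suc 2 k) (cong (2 +_) (2*n≡n+n k))))) 2k+2≤N
    uncovered : ∀ {y} → (∀ x → end (splitAt k x) ≢ y) → ∀ s → end s ≢ y
    uncovered ∉y s = subst (λ s → end s ≢ _) (Finₚ.splitAt-join k k s) (∉y (join k k s))

  adjacent? : ∀ x y → Dec (G x y)
  adjacent? x y = ¬? (x Finₚ.≟ y) ×-dec ¬? (inMatching? x y)

  adjacent-sym : ∀ {x y} → G x y → G y x
  adjacent-sym (x≢y , ¬xy) = x≢y ∘ sym , ¬xy ∘ inMatching-sym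

  nonadjacent⇒matched : ∀ {x y} → x ≢ y → ¬ G x y → InMatching M x y
  nonadjacent⇒matched {x} {y} x≢y ¬xy = decidable-stable (inMatching? x y) λ ¬m → ¬xy (x≢y , ¬m)

  adjacent-to-edge : ∀ {v x y} → v ≢ x → v ≢ y → x ≢ y → G v x ⊎ G v y
  adjacent-to-edge {v} {x} {y} v≢x v≢y x≢y with adjacent? v x | adjacent? v y
  ... | yes vx | _      = inj₁ vx
  ... | no _   | yes vy = inj₂ vy
  ... | no ¬vx | no ¬vy = contradiction
    (inMatching-functional (nonadjacent⇒matched v≢x ¬vx) (nonadjacent⇒matched v≢y ¬vy)) x≢y

  matched⇒commonNeighbour : ∀ {u v z} → InMatching M u v → z ≢ u → z ≢ v → G u z × G z v
  matched⇒commonNeighbour uv z≢u z≢v =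
    (z≢u ∘ sym , λ uz → z≢v (inMatching-functional uz uv)) ,
    (z≢v , λ zv → z≢u (inMatching-functional (inMatching-sym zv) (inMatching-sym uv)))

  dist-exists : 3 ≤ N → ∀ u v → ∃ (Dist G u v)
  dist-exists 3≤N u v with u Finₚ.≟ v
  ... | yes refl = 0 , dist-self u
  ... | no u≢v with adjacent? u v
  ...   | yes uv = 1 , dist-adjacent u≢v uv
  ...   | no ¬uv with z , z≢u , z≢v ← avoid-both 3≤N u v =
    let uz , zv = matched⇒commonNeighbour (nonadjacent⇒matched u≢v ¬uv) z≢u z≢v
    in 2 , dist-two u≢v ¬uv uz zv

-- Palettes

module _ {A : Set} (R : A → A → Set) {m : ℕ} (colour : A → A → Fin m) where

  HasColour : A → Fin m → Set
  HasColour a i = ∃ λ b → R a b × colour a b ≡ i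

  Separates : A → A → Fin m → Set
  Separates a a′ i = (HasColour a i × ¬ HasColour a′ i) ⊎ (¬ HasColour a i × HasColour a′ i)

record SeparatingColouring {A : Set} (R : A → A → Set) (m : ℕ) : Set where
  field
    colour     : A → A → Fin m
    colour-sym : ∀ {a b} → R a b → colour a b ≡ colour b a
    proper     : ∀ {a b b′} → R a b → R a b′ → b ≢ b′ → colour a b ≢ colour a b′
    separating : ∀ {a a′} → a ≢ a′ → ∃ (Separates R colour a a′)

module _ {N m : ℕ} {G : Graph N} (c : ProperEdgeColoring G m) where
  open ProperEdgeColoring c

  InPalette : Fin N → Fin m → Set
  InPalette = HasColour G col

  PalettesSeparate : Set
  PalettesSeparate = ∀ {u w} → u ≢ w → ∃ (Separates G col u w)

⊓-≡1 : ∀ {a b} → 1 ≤ a → 1 ≤ b → a ≡ 1 ⊎ b ≡ 1 → a ⊓ b ≡ 1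
⊓-≡1 _   1≤b (inj₁ refl) = m≤n⇒m⊓n≡m 1≤b
⊓-≡1 1≤a _   (inj₂ refl) = m≥n⇒m⊓n≡n 1≤a

module _ {N k m : ℕ} (M : Matching N k) (3≤N : 3 ≤ N) (c : ProperEdgeColoring (KminusM M) m) where
  open ProperEdgeColoring c

  private
    G : Graph N
    G = KminusM M

  inPalette? : ∀ v i → Dec (InPalette c v i)
  inPalette? v i = Finₚ.any? λ y → adjacent? M v y ×-dec col v y Finₚ.≟ i

  edgeDist-incident : ∀ {v y} → G v y → EdgeDist c v v y 0
  edgeDist-incident vy = 0 , 1 , dist-self _ , dist-adjacent (proj₁ vy) vy , refl

  edgeDist-positive : ∀ {v x y d} → v ≢ x → v ≢ y → EdgeDist c v x y d → 1 ≤ d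
  edgeDist-positive v≢x v≢y (_ , _ , vx , vy , refl) = ⊓-glb (dist-positive v≢x vx) (dist-positive v≢y vy)

  edgeDist-nonincident : ∀ {v x y} → v ≢ x → v ≢ y → G x y → EdgeDist c v x y 1
  edgeDist-nonincident {v} {x} {y} v≢x v≢y xy
    with dx , vx ← dist-exists M 3≤N v x | dy , vy ← dist-exists M 3≤N v y =
    dx , dy , vx , vy , sym (⊓-≡1 (dist-positive v≢x vx) (dist-positive v≢y vy) one-adjacent)
    where
    one-adjacent : dx ≡ 1 ⊎ dy ≡ 1
    one-adjacent with adjacent-to-edge M v≢x v≢y (proj₁ xy)
    ... | inj₁ v~x = inj₁ (dist-unique vx (dist-adjacent v≢x v~x))
    ... | inj₂ v~y = inj₂ (dist-unique vy (dist-adjacent v≢y v~y))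

  missing⇒off-edge : ∀ {v x y i} → ¬ InPalette c v i → G x y → col x y ≡ i → v ≢ x × v ≢ y
  missing⇒off-edge ¬vi xy xy≡i =
    (λ { refl → ¬vi (_ , xy , xy≡i) }) ,
    (λ { refl → ¬vi (_ , adjacent-sym M xy , trans (sym (col-sym _ _ xy)) xy≡i) })

  classDist-inPalette : ∀ {v i} → InPalette c v i → ClassDist c v i 0
  classDist-inPalette (y , vy , vy≡i) = (_ , y , vy , vy≡i , edgeDist-incident vy) , λ _ _ _ _ _ _ → z≤n

  classDist-missing : ∀ {v w i} → ¬ InPalette c v i → InPalette c w i → ClassDist c v i 1
  classDist-missing ¬vi (y , wy , wy≡i) =
    (_ , y , wy , wy≡i , uncurry edgeDist-nonincident (missing⇒off-edge ¬vi wy wy≡i) wy) ,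
    λ x y _ xy xy≡i → uncurry edgeDist-positive (missing⇒off-edge ¬vi xy xy≡i)

  classDist-inPalette-≡0 : ∀ {v i d} → InPalette c v i → ClassDist c v i d → d ≡ 0
  classDist-inPalette-≡0 (y , vy , vy≡i) (_ , nearest) = n≤0⇒n≡0 (nearest _ y 0 vy vy≡i (edgeDist-incident vy))

  classDist-missing-≡1 : ∀ {v i d} → ¬ InPalette c v i → ClassDist c v i d → d ≡ 1
  classDist-missing-≡1 {v} ¬vi ((x , y , xy , xy≡i , vxy) , nearest) =
    ≤-antisym (nearest x y 1 xy xy≡i (uncurry edgeDist-nonincident off-edge xy))
              (uncurry edgeDist-positive off-edge vxy)
    where
    off-edge : v ≢ x × v ≢ y
    off-edge = missing⇒off-edge ¬vi xy xy≡i

  edgeLocating⇔palettesSeparate : IsEdgeLocating c ⇔ PalettesSeparate c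
  edgeLocating⇔palettesSeparate = mk⇔ palettesSeparate edgeLocating
    where
    palettesSeparate : IsEdgeLocating c → PalettesSeparate c
    palettesSeparate locating {u} {w} u≢w
      with i , d , d′ , ui-d , wi-d′ , d≢d′ ← locating u w u≢w
      with inPalette? u i | inPalette? w i
    ... | yes ui | yes wi =
      contradiction (trans (classDist-inPalette-≡0 ui ui-d) (sym (classDist-inPalette-≡0 wi wi-d′))) d≢d′
    ... | yes ui | no ¬wi = i , inj₁ (ui , ¬wi)
    ... | no ¬ui | yes wi = i , inj₂ (¬ui , wi)
    ... | no ¬ui | no ¬wi =
      contradiction (trans (classDist-missing-≡1 ¬ui ui-d) (sym (classDist-missing-≡1 ¬wi wi-d′))) d≢d′

    edgeLocating : PalettesSeparate c → IsEdgeLocating c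
    edgeLocating separate u w u≢w with separate u≢w
    ... | i , inj₁ (ui , ¬wi) = i , 0 , 1 , classDist-inPalette ui , classDist-missing ¬wi ui , λ ()
    ... | i , inj₂ (¬ui , wi) = i , 1 , 0 , classDist-missing ¬ui wi , classDist-inPalette wi , λ ()

module _ {N k : ℕ} (M : Matching N k) (3≤N : 3 ≤ N) where

  edgeLocatingChromaticIndex-viaPalettes : SeparatingColouring (KminusM M) N →
    (∀ {m} (c : ProperEdgeColoring (KminusM M) m) → PalettesSeparate c → N ≤ m) →
    EdgeLocatingChromaticIndex (KminusM M) N
  edgeLocatingChromaticIndex-viaPalettes S lowerBound =
    (c , Equivalence.from (edgeLocating⇔palettesSeparate M 3≤N c) separating) ,
    λ _ c′ locating → lowerBound c′ (Equivalence.to (edgeLocating⇔palettesSeparate M 3≤N c′) locating)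
    where
    open SeparatingColouring S
    c : ProperEdgeColoring (KminusM M) N
    c = record { col = colour ; col-sym = λ _ _ → colour-sym ; proper = λ _ _ _ → proper }

-- The lower bound

record Neighbourhood {N : ℕ} (G : Graph N) (v : Fin N) (p : ℕ) : Set where
  field
    neighbour            : Fin p → Fin N
    neighbour-adjacent   : ∀ j → G v (neighbour j)
    neighbour-injective  : Injective _≡_ _≡_ neighbour
    neighbour-surjective : ∀ {y} → G v y → ∃ λ j → neighbour j ≡ y

module _ {N m : ℕ} {G : Graph N} (c : ProperEdgeColoring G m) {v : Fin N} {p : ℕ} (Γ : Neighbourhood G v p) where
  open ProperEdgeColoring c
  open Neighbourhood Γ

  private
    neighbourColour : Fin p → Fin m
    neighbourColour j = col v (neighbour j)

    neighbourColour-injective : Injective _≡_ _≡_ neighbourColour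
    neighbourColour-injective {j} {j′} eq with j Finₚ.≟ j′
    ... | yes j≡j′ = j≡j′
    ... | no j≢j′  = contradiction eq
      (proper _ _ _ (neighbour-adjacent j) (neighbour-adjacent j′) (j≢j′ ∘ neighbour-injective))

    inPalette⇔neighbourColour : ∀ {i} → InPalette c v i ⇔ ∃ λ j → neighbourColour j ≡ i
    inPalette⇔neighbourColour = mk⇔
      (λ (y , vy , vy≡i) → let j , j↦y = neighbour-surjective vy in j , trans (cong (col v) j↦y) vy≡i)
      (λ (j , j↦i) → neighbour j , neighbour-adjacent j , j↦i)

  fullPalette : m ≤ p → ∀ i → InPalette c v i
  fullPalette m≤p i =
    Equivalence.from inPalette⇔neighbourColour (injective⇒surjective neighbourColour-injective m≤p i)

  palette-missesOne : m ≡ suc p → ∃ λ a → ¬ InPalette c v a × (∀ i → i ≢ a → InPalette c v i)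
  palette-missesOne refl with a , unhit , hit ← injective⇒missesOne neighbourColour-injective =
    a , (λ va → let j , j↦a = Equivalence.to inPalette⇔neighbourColour va in unhit j j↦a) ,
    λ i i≢a → Equivalence.from inPalette⇔neighbourColour (hit i i≢a)

module _ {N k : ℕ} (M : Matching (suc N) k) {v : Fin (suc N)} where

  unmatchedNeighbourhood : (∀ y → ¬ InMatching M v y) → Neighbourhood (KminusM M) v N
  unmatchedNeighbourhood unmatched = record
    { neighbour            = punchIn v
    ; neighbour-adjacent   = λ j → Finₚ.punchInᵢ≢i v j ∘ sym , unmatched _
    ; neighbour-injective  = Finₚ.punchIn-injective v _ _
    ; neighbour-surjective = λ vy → punchOut (proj₁ vy) , Finₚ.punchIn-punchOut (proj₁ vy)
    }

module _ {N k : ℕ} (M : Matching (suc (suc N)) k) {v q : Fin (suc (suc N))} (vq : InMatching M v q) where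

  private
    v≢q : v ≢ q
    v≢q refl = inMatching-irreflexive M vq

    q′ : Fin (suc N)
    q′ = punchOut v≢q

    neighbour : Fin N → Fin (suc (suc N))
    neighbour j = punchIn v (punchIn q′ j)

    neighbour≢q : ∀ j → neighbour j ≢ q
    neighbour≢q j eq = Finₚ.punchInᵢ≢i q′ j
      (Finₚ.punchIn-injective v _ _ (trans eq (sym (Finₚ.punchIn-punchOut v≢q))))

    neighbour-surjective : ∀ {y} → KminusM M v y → ∃ λ j → neighbour j ≡ y
    neighbour-surjective (v≢y , ¬vy) = punchOut q′≢y′ ,
      trans (cong (punchIn v) (Finₚ.punchIn-punchOut q′≢y′)) (Finₚ.punchIn-punchOut v≢y)
      where
      q′≢y′ : q′ ≢ punchOut v≢y
      q′≢y′ eq = ¬vy (subst (InMatching M v)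
        (trans (sym (Finₚ.punchIn-punchOut v≢q)) (trans (cong (punchIn v) eq) (Finₚ.punchIn-punchOut v≢y))) vq)

  matchedNeighbourhood : Neighbourhood (KminusM M) v N
  matchedNeighbourhood = record
    { neighbour            = neighbour
    ; neighbour-adjacent   = λ j → Finₚ.punchInᵢ≢i v _ ∘ sym ,
                                   λ vj → neighbour≢q j (inMatching-functional M vj vq)
    ; neighbour-injective  = Finₚ.punchIn-injective q′ _ _ ∘ Finₚ.punchIn-injective v _ _
    ; neighbour-surjective = neighbour-surjective
    }

module _ {N k m : ℕ} (M : Matching N k) (c : ProperEdgeColoring (KminusM M) m)
         (separate : PalettesSeparate c) where

  palette-injective : ∀ {u w} → (∀ i → InPalette c u i ⇔ InPalette c w i) → u ≡ w
  palette-injective {u} {w} same = decidable-stable (u Finₚ.≟ w) λ u≢w → indistinguishable (separate u≢w)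
    where
    indistinguishable : ¬ ∃ (Separates (KminusM M) (ProperEdgeColoring.col c) u w)
    indistinguishable (i , inj₁ (ui , ¬wi)) = ¬wi (Equivalence.to (same i) ui)
    indistinguishable (i , inj₂ (¬ui , wi)) = ¬ui (Equivalence.from (same i) wi)

  fullPalettes⇒≡ : ∀ {u w} → (∀ i → InPalette c u i) → (∀ i → InPalette c w i) → u ≡ w
  fullPalettes⇒≡ ui wi = palette-injective λ i → mk⇔ (λ _ → wi i) (λ _ → ui i)

  sameMissingColour⇒≡ : ∀ {u w a} →
    ¬ InPalette c u a → (∀ i → i ≢ a → InPalette c u i) →
    ¬ InPalette c w a → (∀ i → i ≢ a → InPalette c w i) → u ≡ w
  sameMissingColour⇒≡ {a = a} ¬ua ui ¬wa wi = palette-injective same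
    where
    same : ∀ i → InPalette c _ i ⇔ InPalette c _ i
    same i with i Finₚ.≟ a
    ... | yes refl = mk⇔ (⊥-elim ∘ ¬ua) (⊥-elim ∘ ¬wa)
    ... | no i≢a   = mk⇔ (λ _ → wi i i≢a) (λ _ → ui i i≢a)

module _ {N k m : ℕ} (M : Matching (suc N) k) (c : ProperEdgeColoring (KminusM M) m)
         (separate : PalettesSeparate c) where

  twoUnmatched⇒lowerBound : ∀ {u w} → u ≢ w →
    (∀ y → ¬ InMatching M u y) → (∀ y → ¬ InMatching M w y) → suc N ≤ m
  twoUnmatched⇒lowerBound u≢w u-unmatched w-unmatched = ≮⇒≥ λ m<1+N → u≢w (fullPalettes⇒≡ M c separate
    (fullPalette c (unmatchedNeighbourhood M u-unmatched) (s≤s⁻¹ m<1+N))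
    (fullPalette c (unmatchedNeighbourhood M w-unmatched) (s≤s⁻¹ m<1+N)))

module _ {N k m : ℕ} (M : Matching (suc (suc N)) k) (c : ProperEdgeColoring (KminusM M) m)
         (separate : PalettesSeparate c) where

  allMatched⇒lowerBound : (∀ v → ∃ (InMatching M v)) → suc (suc N) ≤ m
  allMatched⇒lowerBound matched = ≮⇒≥ λ m<2+N → case m≤n⇒m<n∨m≡n (s≤s⁻¹ m<2+N) of λ where
      (inj₁ m<1+N) → Finₚ.0≢1+n (fullPalettes⇒≡ M c separate
        (fullPalette c (Γ zero) (s≤s⁻¹ m<1+N)) (fullPalette c (Γ (suc zero)) (s≤s⁻¹ m<1+N)))
      (inj₂ m≡1+N) →
        let missing v = proj₁ (palette-missesOne c (Γ v) m≡1+N)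
            u , w , u<w , au≡aw = Finₚ.pigeonhole m<2+N missing
            ¬ua , ua = proj₂ (palette-missesOne c (Γ u) m≡1+N)
            ¬wa , wa = proj₂ (palette-missesOne c (Γ w) m≡1+N)
        in Finₚ.<⇒≢ u<w (sameMissingColour⇒≡ M c separate ¬ua ua
             (subst (λ a → ¬ InPalette c w a) (sym au≡aw) ¬wa)
             (subst (λ a → ∀ i → i ≢ a → InPalette c w i) (sym au≡aw) wa))
    where
    Γ : ∀ v → Neighbourhood (KminusM M) v N
    Γ v = matchedNeighbourhood M (proj₂ (matched v))

-- Cocktail party graphs

module _ {A B : Set} {R : A → A → Set} {S : B → B → Set} (ι : A ↔ B)
         (ι-iso : ∀ {a b} → S (Inverse.to ι a) (Inverse.to ι b) ⇔ R a b) where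
  open Inverse ι

  private
    S⇒R : ∀ {x y} → S x y → R (from x) (from y)
    S⇒R {x} {y} = Equivalence.to ι-iso ∘ subst₂ S (sym (strictlyInverseˡ x)) (sym (strictlyInverseˡ y))

    R⇒S : ∀ {x b} → R (from x) b → S x (to b)
    R⇒S {x} = subst (λ z → S z _) (strictlyInverseˡ x) ∘ Equivalence.from ι-iso

    from-injective : ∀ {x y} → from x ≡ from y → x ≡ y
    from-injective {x} {y} eq = trans (sym (strictlyInverseˡ x)) (trans (cong to eq) (strictlyInverseˡ y))

  pullback : ∀ {m} → SeparatingColouring R m → SeparatingColouring S m
  pullback {m} C = record
    { colour     = pulledColour
    ; colour-sym = colour-sym ∘ S⇒R
    ; proper     = λ xy xy′ y≢y′ → proper (S⇒R xy) (S⇒R xy′) (y≢y′ ∘ from-injective)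
    ; separating = λ x≢x′ → map₂ reflect (separating (x≢x′ ∘ from-injective))
    }
    where
    open SeparatingColouring C

    pulledColour : B → B → Fin m
    pulledColour x y = colour (from x) (from y)

    hasColour⇔ : ∀ {x i} → HasColour S pulledColour x i ⇔ HasColour R colour (from x) i
    hasColour⇔ {x} = mk⇔
      (λ (y , xy , xy≡i) → from y , S⇒R xy , xy≡i)
      (λ (b , xb , xb≡i) → to b , R⇒S xb , trans (cong (colour (from x)) (strictlyInverseʳ b)) xb≡i)

    reflect : ∀ {x x′ i} → Separates R colour (from x) (from x′) i → Separates S pulledColour x x′ i
    reflect (inj₁ (xi , ¬x′i)) = inj₁ (Equivalence.from hasColour⇔ xi , ¬x′i ∘ Equivalence.to hasColour⇔)
    reflect (inj₂ (¬xi , x′i)) = inj₂ (¬xi ∘ Equivalence.to hasColour⇔ , Equivalence.from hasColour⇔ x′i)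

-- Couple i of the cocktail party graph is {inj₁ i, inj₂ i}; its edge is deleted unless
-- i is the distinguished uncoupled index (if any).
Label : ℕ → Set
Label n = Fin n ⊎ Fin n

Coupled : ∀ {n} → Maybe (Fin n) → Label n → Set
Coupled u a = u ≢ just (reduce a)

CocktailParty : ∀ {n} → Maybe (Fin n) → Label n → Label n → Set
CocktailParty u a b = a ≢ b × ¬ (b ≡ swap a × Coupled u a)

sameCouple : ∀ {n} {a a′ : Label n} → reduce a ≡ reduce a′ → a ≡ a′ ⊎ a′ ≡ swap a
sameCouple {a = inj₁ i} {inj₁ i} refl = inj₁ refl
sameCouple {a = inj₁ i} {inj₂ i} refl = inj₂ refl
sameCouple {a = inj₂ i} {inj₁ i} refl = inj₂ refl
sameCouple {a = inj₂ i} {inj₂ i} refl = inj₁ refl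

coupled? : ∀ {n} (u : Maybe (Fin n)) a → Dec (Coupled u a)
coupled? u a = ¬? (Maybeₚ.≡-dec Finₚ._≟_ u (just (reduce a)))

uncoupled : ∀ {n} {u : Maybe (Fin n)} {a} → ¬ Coupled u a → u ≡ just (reduce a)
uncoupled {u = u} {a} = decidable-stable (Maybeₚ.≡-dec Finₚ._≟_ u (just (reduce a)))

record Labelling {N k : ℕ} (M : Matching N k) (n : ℕ) (u : Maybe (Fin n)) : Set where
  field
    vertex           : Label n → Fin N
    vertex-injective : Injective _≡_ _≡_ vertex
    vertex-covers    : N ≤ 2 * n
    matched⇒couple   : ∀ {a b} → InMatching M (vertex a) (vertex b) → b ≡ swap a × Coupled u a
    couple⇒matched   : ∀ {a} → Coupled u a → InMatching M (vertex a) (vertex (swap a))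

  vertex↔ : Label n ↔ Fin N
  vertex↔ = mk↔ₛ′ vertex label vertex-label (λ a → vertex-injective (vertex-label (vertex a)))
    where
    vertex-onto : StrictlySurjective _≡_ vertex
    vertex-onto = ⊎-injective⇒surjective vertex-injective vertex-covers
    label : Fin N → Label n
    label = proj₁ ∘ vertex-onto
    vertex-label : ∀ v → vertex (label v) ≡ v
    vertex-label = proj₂ ∘ vertex-onto

  adjacent⇔cocktailParty : ∀ {a b} → KminusM M (vertex a) (vertex b) ⇔ CocktailParty u a b
  adjacent⇔cocktailParty = mk⇔
    (λ (va≢vb , ¬matched) → va≢vb ∘ cong vertex ,
       λ (b≡ , coupled) → ¬matched (subst (InMatching M _ ∘ vertex) (sym b≡) (couple⇒matched coupled)))
    (λ (a≢b , ¬couple) → a≢b ∘ vertex-injective , ¬couple ∘ matched⇒couple)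

  transferColouring : ∀ {m} → SeparatingColouring (CocktailParty u) m → SeparatingColouring (KminusM M) m
  transferColouring = pullback vertex↔ adjacent⇔cocktailParty

module _ {N k : ℕ} (M : Matching N k) where
  open Matching M

  perfectLabelling : N ≤ 2 * k → Labelling M k nothing
  perfectLabelling N≤2k = record
    { vertex           = end
    ; vertex-injective = end-injective
    ; vertex-covers    = N≤2k
    ; matched⇒couple   = λ {a} ab → end-injective (inMatching-functional M ab (ends-matched M a)) , λ ()
    ; couple⇒matched   = λ {a} _ → ends-matched M a
    }

  module _ {u w : Fin N} (u≢w : u ≢ w) (∉u : ∀ s → end s ≢ u) (∉w : ∀ s → end s ≢ w) where

    private
      vertex : Label (suc k) → Fin N
      vertex (inj₁ i) = (u ∷ end ∘ inj₁) i
      vertex (inj₂ i) = (w ∷ end ∘ inj₂) i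

      sides-disjoint : ∀ i j → vertex (inj₁ i) ≢ vertex (inj₂ j)
      sides-disjoint zero    zero    = u≢w
      sides-disjoint zero    (suc j) = ∉u (inj₂ j) ∘ sym
      sides-disjoint (suc i) zero    = ∉w (inj₁ i)
      sides-disjoint (suc i) (suc j) eq with () ← end-injective eq

      vertex-injective : Injective _≡_ _≡_ vertex
      vertex-injective {inj₁ i} {inj₁ j} =
        cong inj₁ ∘ ∷-injective (Sumₚ.inj₁-injective ∘ end-injective) (∉u ∘ inj₁)
      vertex-injective {inj₁ i} {inj₂ j} = ⊥-elim ∘ sides-disjoint i j
      vertex-injective {inj₂ i} {inj₁ j} = ⊥-elim ∘ sides-disjoint j i ∘ sym
      vertex-injective {inj₂ i} {inj₂ j} =
        cong inj₂ ∘ ∷-injective (Sumₚ.inj₂-injective ∘ end-injective) (∉w ∘ inj₂)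

      matched⇒couple : ∀ {a b} → InMatching M (vertex a) (vertex b) → b ≡ swap a × Coupled (just zero) a
      matched⇒couple {inj₁ zero}    ab = ⊥-elim (uncovered⇒unmatched M ∉u _ ab)
      matched⇒couple {inj₂ zero}    ab = ⊥-elim (uncovered⇒unmatched M ∉w _ ab)
      matched⇒couple {inj₁ (suc i)} ab =
        vertex-injective (inMatching-functional M ab (ends-matched M (inj₁ i))) , λ ()
      matched⇒couple {inj₂ (suc i)} ab =
        vertex-injective (inMatching-functional M ab (ends-matched M (inj₂ i))) , λ ()

      couple⇒matched : ∀ {a} → Coupled (just zero) a → InMatching M (vertex a) (vertex (swap a))
      couple⇒matched {inj₁ zero}    coupled = contradiction refl coupled
      couple⇒matched {inj₂ zero}    coupled = contradiction refl coupled
      couple⇒matched {inj₁ (suc i)} _       = ends-matched M (inj₁ i)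
      couple⇒matched {inj₂ (suc i)} _       = ends-matched M (inj₂ i)

    nearPerfectLabelling : N ≤ 2 * suc k → Labelling M (suc k) (just zero)
    nearPerfectLabelling N≤2k+2 = record
      { vertex           = vertex
      ; vertex-injective = vertex-injective
      ; vertex-covers    = N≤2k+2
      ; matched⇒couple   = matched⇒couple
      ; couple⇒matched   = λ {a} → couple⇒matched {a}
      }

-- Sum colourings

<⇒≢+ : ∀ {x y N} → x < N → x ≢ y + N
<⇒≢+ {y = y} {N} x<N refl = ≤⇒≯ (m≤n+m N y) x<N

module _ (N : ℕ) .{{_ : NonZero N}} where

  %-below-double : ∀ {x} → x < N + N → x % N ≡ x ⊎ x % N + N ≡ x
  %-below-double {x} x<2N with x <? N
  ... | yes x<N = inj₁ (m<n⇒m%n≡m x<N)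
  ... | no x≮N  = inj₂ (begin
    x % N + N        ≡⟨ cong (_+ N) (m≤n⇒[n∸m]%m≡n%m N≤x) ⟨
    (x ∸ N) % N + N  ≡⟨ cong (_+ N) (m<n⇒m%n≡m x∸N<N) ⟩
    x ∸ N + N        ≡⟨ m∸n+n≡m N≤x ⟩
    x                ∎)
    where
    open ≡-Reasoning
    N≤x : N ≤ x
    N≤x = ≮⇒≥ x≮N
    x∸N<N : x ∸ N < N
    x∸N<N = +-cancelʳ-< _ _ N (subst (_< N + N) (sym (m∸n+n≡m N≤x)) x<2N)

  %-collision : ∀ {x y} → x < N + N → y < N + N → x % N ≡ y % N → x ≡ y ⊎ x ≡ y + N ⊎ y ≡ x + N
  %-collision x<2N y<2N x≡y with %-below-double x<2N | %-below-double y<2N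
  ... | inj₁ x%≡x | inj₁ y%≡y = inj₁ (trans (sym x%≡x) (trans x≡y y%≡y))
  ... | inj₁ x%≡x | inj₂ y%≡y = inj₂ (inj₂ (trans (sym y%≡y) (cong (_+ N) (trans (sym x≡y) x%≡x))))
  ... | inj₂ x%≡x | inj₁ y%≡y = inj₂ (inj₁ (trans (sym x%≡x) (cong (_+ N) (trans x≡y y%≡y))))
  ... | inj₂ x%≡x | inj₂ y%≡y = inj₁ (trans (sym x%≡x) (trans (cong (_+ N) x≡y) y%≡y))

  +-cancelˡ-% : ∀ {a x y} → a < N → x < N → y < N → (a + x) % N ≡ (a + y) % N → x ≡ y
  +-cancelˡ-% {a} {x} {y} a<N x<N y<N eq with %-collision (+-mono-< a<N x<N) (+-mono-< a<N y<N) eq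
  ... | inj₁ same          = +-cancelˡ-≡ a x y same
  ... | inj₂ (inj₁ higher) = contradiction (+-cancelˡ-≡ a x (y + N) (trans higher (+-assoc a y N))) (<⇒≢+ x<N)
  ... | inj₂ (inj₂ lower)  = contradiction (+-cancelˡ-≡ a y (x + N) (trans lower (+-assoc a x N))) (<⇒≢+ y<N)

double-even : ∀ x → (2 * x) % 2 ≡ 0
double-even x = trans (cong (_% 2) (*-comm 2 x)) (m*n%n≡0 x 2)

suc-double-odd : ∀ x → suc (2 * x) % 2 ≡ 1
suc-double-odd x = trans (cong (λ y → suc y % 2) (*-comm 2 x)) ([m+kn]%n≡m%n 1 x 2)

halve-+ : ∀ {x y m} → 2 * x ≡ 2 * y + 2 * m → x ≡ y + m
halve-+ {x} {y} {m} eq = *-cancelˡ-≡ x (y + m) 2 (trans eq (sym (*-distribˡ-+ 2 y m)))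

double-mono-< : ∀ {x m} → x < m → suc (2 * x) < 2 * m
double-mono-< x<m = ≤-trans (≤-reflexive (sym (*-suc 2 _))) (*-monoʳ-≤ 2 x<m)

record SumLabelling (n : ℕ) : Set where
  field
    value           : Label (suc n) → ℕ
    value<          : ∀ a → value a < 2 * suc n
    value-injective : Injective _≡_ _≡_ value
    coupleSum-odd   : ∀ a → (value a + value (swap a)) % 2 ≡ 1
    antipodal-coupleSums-differ : ∀ {a a′} → value a ≡ value a′ + suc n →
      (value a + value (swap a)) % (2 * suc n) ≢ (value a′ + value (swap a′)) % (2 * suc n)

-- A vertex misses exactly its loop colour 2·value a, which is even, and, if coupled,
-- its couple colour, which is odd.
module SumColouring {n : ℕ} (L : SumLabelling n) (u : Maybe (Fin (suc n))) where
  open SumLabelling L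

  private
    N : ℕ
    N = 2 * suc n

  colour : Label (suc n) → Label (suc n) → Fin N
  colour a b = fromℕ< (m%n<n (value a + value b) N)

  toℕ-colour : ∀ a b → toℕ (colour a b) ≡ (value a + value b) % N
  toℕ-colour a b = Finₚ.toℕ-fromℕ< _

  toℕ-loopColour : ∀ a → toℕ (colour a a) ≡ (2 * value a) % N
  toℕ-loopColour a = trans (toℕ-colour a a) (cong (_% N) (sym (2*n≡n+n (value a))))

  colour-parity : ∀ a b → toℕ (colour a b) % 2 ≡ (value a + value b) % 2
  colour-parity a b =
    trans (cong (_% 2) (toℕ-colour a b)) (m∣n⇒o%n%m≡o%m 2 N (value a + value b) (m∣m*n (suc n)))

  colour-sym : ∀ a b → colour a b ≡ colour b a
  colour-sym a b = cong (λ x → fromℕ< (m%n<n x N)) (+-comm (value a) (value b))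

  row-injective : ∀ a → Injective _≡_ _≡_ (colour a)
  row-injective a {b} {b′} eq = value-injective (+-cancelˡ-% N (value< a) (value< b) (value< b′)
    (trans (sym (toℕ-colour a b)) (trans (cong toℕ eq) (toℕ-colour a b′))))

  row-surjective : ∀ a → StrictlySurjective _≡_ (colour a)
  row-surjective a = ⊎-injective⇒surjective (row-injective a) ≤-refl

  Missing : Label (suc n) → Fin N → Set
  Missing a c = c ≡ colour a a ⊎ (c ≡ colour a (swap a) × Coupled u a)

  hasColour⇔¬missing : ∀ {a c} → HasColour (CocktailParty u) colour a c ⇔ (¬ Missing a c)
  hasColour⇔¬missing {a} {c} = mk⇔ present⇒¬missing ¬missing⇒present
    where
    present⇒¬missing : HasColour (CocktailParty u) colour a c → ¬ Missing a c
    present⇒¬missing (b , (a≢b , _) , ab≡c) (inj₁ c≡aa) = a≢b (sym (row-injective a (trans ab≡c c≡aa)))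
    present⇒¬missing (b , (_ , ¬couple) , ab≡c) (inj₂ (c≡as , coupled)) =
      ¬couple (row-injective a (trans ab≡c c≡as) , coupled)

    ¬missing⇒present : ¬ Missing a c → HasColour (CocktailParty u) colour a c
    ¬missing⇒present ¬missing with b , ab≡c ← row-surjective a c =
      b , ((λ { refl → ¬missing (inj₁ (sym ab≡c)) }) ,
           (λ { (refl , coupled) → ¬missing (inj₂ (sym ab≡c , coupled)) })) , ab≡c

  loop≢coupleColour : ∀ a b → colour a a ≢ colour b (swap b)
  loop≢coupleColour a b eq = 0≢1+n (begin
    0                               ≡⟨ double-even (value a) ⟨
    (2 * value a) % 2               ≡⟨ cong (_% 2) (2*n≡n+n (value a)) ⟩
    (value a + value a) % 2         ≡⟨ colour-parity a a ⟨
    toℕ (colour a a) % 2            ≡⟨ cong (λ c → toℕ c % 2) eq ⟩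
    toℕ (colour b (swap b)) % 2     ≡⟨ colour-parity b (swap b) ⟩
    (value b + value (swap b)) % 2  ≡⟨ coupleSum-odd b ⟩
    1                               ∎)
    where open ≡-Reasoning

  antipodal⇒coupleColours-differ : ∀ {b b′} → value b ≡ value b′ + suc n →
    colour b (swap b) ≢ colour b′ (swap b′)
  antipodal⇒coupleColours-differ shifted eq = antipodal-coupleSums-differ shifted
    (trans (sym (toℕ-colour _ _)) (trans (cong toℕ eq) (toℕ-colour _ _)))

  double-value< : ∀ a → 2 * value a < N + N
  double-value< a = subst (2 * value a <_) (2*n≡n+n N) (*-monoʳ-< 2 (value< a))

  loopsCollide⇒coupleColours-differ : ∀ {a a′} → a ≢ a′ → colour a a ≡ colour a′ a′ →
    colour a (swap a) ≢ colour a′ (swap a′)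
  loopsCollide⇒coupleColours-differ {a} {a′} a≢a′ eq
    with %-collision N (double-value< a) (double-value< a′)
           (trans (sym (toℕ-loopColour a)) (trans (cong toℕ eq) (toℕ-loopColour a′)))
  ... | inj₁ same          = contradiction (value-injective (*-cancelˡ-≡ (value a) (value a′) 2 same)) a≢a′
  ... | inj₂ (inj₁ higher) = antipodal⇒coupleColours-differ (halve-+ {y = value a′} {suc n} higher)
  ... | inj₂ (inj₂ lower)  = antipodal⇒coupleColours-differ (halve-+ {y = value a} {suc n} lower) ∘ sym

  missing-separates : ∀ {a a′} → a ≢ a′ →
    ∃ λ c → (Missing a c × ¬ Missing a′ c) ⊎ (¬ Missing a c × Missing a′ c)
  missing-separates {a} {a′} a≢a′ with colour a a Finₚ.≟ colour a′ a′
  ... | no loops-differ = colour a a , inj₁ (inj₁ refl , λ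
          { (inj₁ eq)       → loops-differ eq
          ; (inj₂ (eq , _)) → loop≢coupleColour a a′ eq })
  ... | yes loops-collide with coupled? u a | coupled? u a′
  ...   | yes coupled | _ = colour a (swap a) , inj₁ (inj₂ (refl , coupled) , λ
          { (inj₁ eq)       → loop≢coupleColour a′ a (sym eq)
          ; (inj₂ (eq , _)) → loopsCollide⇒coupleColours-differ a≢a′ loops-collide eq })
  ...   | no _ | yes coupled′ = colour a′ (swap a′) , inj₂ ((λ
          { (inj₁ eq)       → loop≢coupleColour a a′ (sym eq)
          ; (inj₂ (eq , _)) → loopsCollide⇒coupleColours-differ a≢a′ loops-collide (sym eq) }) ,
          inj₂ (refl , coupled′))
  -- Both uncoupled: they form the one uncoupled couple, and share its couple colour.
  ...   | no ¬coupled | no ¬coupled′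
    with sameCouple (Maybeₚ.just-injective
           (trans (sym (uncoupled {a = a} ¬coupled)) (uncoupled {a = a′} ¬coupled′)))
  ...     | inj₁ a≡a′ = contradiction a≡a′ a≢a′
  ...     | inj₂ refl = ⊥-elim (loopsCollide⇒coupleColours-differ a≢a′ loops-collide
    (trans (colour-sym a (swap a)) (cong (colour (swap a)) (sym (Sumₚ.swap-involutive a)))))

  sumColouring : SeparatingColouring (CocktailParty u) N
  sumColouring = record
    { colour     = colour
    ; colour-sym = λ {a} {b} _ → colour-sym a b
    ; proper     = λ {a} _ _ b≢b′ → b≢b′ ∘ row-injective a
    ; separating = map₂ fromMissing ∘ missing-separates
    }
    where
    open Equivalence
    fromMissing : ∀ {a a′ c} → (Missing a c × ¬ Missing a′ c) ⊎ (¬ Missing a c × Missing a′ c) →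
      Separates (CocktailParty u) colour a a′ c
    fromMissing (inj₁ (missing , ¬missing′)) =
      inj₂ ((λ present → to hasColour⇔¬missing present missing) , from hasColour⇔¬missing ¬missing′)
    fromMissing (inj₂ (¬missing , missing′)) =
      inj₁ (from hasColour⇔¬missing ¬missing , λ present′ → to hasColour⇔¬missing present′ missing′)

oddSumLabelling : ∀ q → SumLabelling (2 * suc q)
oddSumLabelling q = record
  { value                       = value
  ; value<                      = value<
  ; value-injective             = value-injective
  ; coupleSum-odd               = λ a → trans (cong (_% 2) (coupleSum a)) (suc-double-odd (double (reduce a)))
  ; antipodal-coupleSums-differ = λ {a} {a′} → antipodal {a} {a′}
  }
  where
  n : ℕ
  n = suc (2 * suc q)

  double : Fin n → ℕ
  double i = 2 * toℕ i

  value : Label n → ℕ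
  value (inj₁ i) = double i
  value (inj₂ i) = suc (double i)

  value-bounds : ∀ a → double (reduce a) ≤ value a × value a ≤ suc (double (reduce a))
  value-bounds (inj₁ i) = ≤-refl , n≤1+n _
  value-bounds (inj₂ i) = n≤1+n _ , ≤-refl

  value< : ∀ a → value a < 2 * n
  value< a = ≤-<-trans (proj₂ (value-bounds a)) (double-mono-< (Finₚ.toℕ<n (reduce a)))

  value-injective : Injective _≡_ _≡_ value
  value-injective {inj₁ i} {inj₁ j} eq = cong inj₁ (Finₚ.toℕ-injective (*-cancelˡ-≡ _ _ 2 eq))
  value-injective {inj₁ i} {inj₂ j} eq = contradiction eq (even≢odd (toℕ i) (toℕ j))
  value-injective {inj₂ i} {inj₁ j} eq = contradiction (sym eq) (even≢odd (toℕ j) (toℕ i))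
  value-injective {inj₂ i} {inj₂ j} eq = cong inj₂ (Finₚ.toℕ-injective (*-cancelˡ-≡ _ _ 2 (suc-injective eq)))

  coupleSum : ∀ a → value a + value (swap a) ≡ suc (2 * double (reduce a))
  coupleSum (inj₁ i) = trans (+-suc (double i) (double i)) (cong suc (sym (2*n≡n+n (double i))))
  coupleSum (inj₂ i) = cong suc (sym (2*n≡n+n (double i)))

  coupleSum< : ∀ a → suc (2 * double (reduce a)) < 2 * n + 2 * n
  coupleSum< a = subst (suc (2 * double (reduce a)) <_) (2*n≡n+n (2 * n))
    (double-mono-< (*-monoʳ-< 2 (Finₚ.toℕ<n (reduce a))))

  sameCouple-notAntipodal : ∀ {a a′} → double (reduce a) ≡ double (reduce a′) → value a ≢ value a′ + n
  sameCouple-notAntipodal {a} {a′} X≡X′ shifted = contradiction (+-cancelˡ-≤ X n 1 (begin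
    X + n         ≤⟨ +-monoˡ-≤ n (subst (_≤ value a′) (sym X≡X′) (proj₁ (value-bounds a′))) ⟩
    value a′ + n  ≡⟨ shifted ⟨
    value a       ≤⟨ proj₂ (value-bounds a) ⟩
    suc X         ≡⟨ +-comm 1 X ⟩
    X + 1         ∎)) λ { (s≤s ()) }
    where
    open ≤-Reasoning
    X : ℕ
    X = double (reduce a)

  doubles-notAntipodal : ∀ i i′ → 2 * i ≢ 2 * i′ + n
  doubles-notAntipodal i i′ eq = even≢odd i (i′ + suc q) (begin
    2 * i                     ≡⟨ eq ⟩
    2 * i′ + n                ≡⟨ +-suc (2 * i′) _ ⟩
    suc (2 * i′ + 2 * suc q)  ≡⟨ cong suc (*-distribˡ-+ 2 i′ (suc q)) ⟨
    suc (2 * (i′ + suc q))    ∎)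
    where open ≡-Reasoning

  antipodal : ∀ {a a′} → value a ≡ value a′ + n →
    (value a + value (swap a)) % (2 * n) ≢ (value a′ + value (swap a′)) % (2 * n)
  antipodal {a} {a′} shifted eq
    with %-collision (2 * n) (coupleSum< a) (coupleSum< a′)
           (trans (cong (_% (2 * n)) (sym (coupleSum a))) (trans eq (cong (_% (2 * n)) (coupleSum a′))))
  ... | inj₁ same          = sameCouple-notAntipodal {a} {a′}
    (*-cancelˡ-≡ (double (reduce a)) (double (reduce a′)) 2 (suc-injective same)) shifted
  ... | inj₂ (inj₁ higher) = doubles-notAntipodal (toℕ (reduce a)) (toℕ (reduce a′))
    (halve-+ {y = double (reduce a′)} {n} (suc-injective higher))
  ... | inj₂ (inj₂ lower)  = doubles-notAntipodal (toℕ (reduce a′)) (toℕ (reduce a))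
    (halve-+ {y = double (reduce a)} {n} (suc-injective lower))

suc-%-absorb : ∀ m n .{{_ : NonZero n}} → suc (m % n) % n ≡ suc m % n
suc-%-absorb m n = begin
  (1 + m % n) % n          ≡⟨ %-distribˡ-+ 1 (m % n) n ⟩
  (1 % n + m % n % n) % n  ≡⟨ cong (λ r → (1 % n + r) % n) (m%n%n≡m%n m n) ⟩
  (1 % n + m % n) % n      ≡⟨ %-distribˡ-+ 1 m n ⟨
  (1 + m) % n              ∎
  where open ≡-Reasoning

-- Couple i sits at i and n + (i + 1 mod n).  The only antipodal pairs are inj₂ i and
-- inj₁ (i + 1 mod n), whose couple sums differ in a summand i against i + 2 mod n.
evenSumLabelling : ∀ q → SumLabelling (suc (2 * suc q))
evenSumLabelling q = record
  { value                       = value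
  ; value<                      = value<
  ; value-injective             = value-injective
  ; coupleSum-odd               = coupleSum-odd
  ; antipodal-coupleSums-differ = λ {a} {a′} → antipodal {a} {a′}
  }
  where
  n : ℕ
  n = suc (suc (2 * suc q))

  next : ℕ → ℕ
  next x = suc x % n

  next< : ∀ x → next x < n
  next< x = m%n<n (suc x) n

  next-wraps : ∀ {x} → x < n → next x ≡ suc x ⊎ next x + n ≡ suc x
  next-wraps x<n = %-below-double n (≤-<-trans x<n (m<m+n n (s≤s z≤n)))

  next-injective : ∀ {x y} → x < n → y < n → next x ≡ next y → x ≡ y
  next-injective = +-cancelˡ-% n (s≤s (s≤s z≤n))

  next²≢id : ∀ {x} → x < n → next (next x) ≢ x
  next²≢id {x} x<n loop = case %-below-double n (+-mono-< 2<n x<n) of λ where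
      (inj₁ no-wrap) → m≢1+n+m x (trans (sym loop′) no-wrap)
      (inj₂ wrap)    → <⇒≢ 2<n (sym (+-cancelˡ-≡ x n 2
                         (trans (cong (_+ n) (sym loop′)) (trans wrap (+-comm 2 x)))))
    where
    2<n : 2 < n
    2<n = s≤s (s≤s (s≤s z≤n))
    loop′ : suc (suc x) % n ≡ x
    loop′ = trans (sym (suc-%-absorb (suc x) n)) loop

  value : Label n → ℕ
  value (inj₁ i) = toℕ i
  value (inj₂ i) = n + next (toℕ i)

  value< : ∀ a → value a < 2 * n
  value< (inj₁ i) = <-≤-trans (Finₚ.toℕ<n i) (m≤m+n n _)
  value< (inj₂ i) = subst (value (inj₂ i) <_) (sym (2*n≡n+n n)) (+-monoʳ-< n (next< (toℕ i)))

  value-injective : Injective _≡_ _≡_ value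
  value-injective {inj₁ i} {inj₁ j} eq = cong inj₁ (Finₚ.toℕ-injective eq)
  value-injective {inj₁ i} {inj₂ j} eq = contradiction (subst (n ≤_) (sym eq) (m≤m+n n _)) (<⇒≱ (Finₚ.toℕ<n i))
  value-injective {inj₂ i} {inj₁ j} eq = contradiction (subst (n ≤_) eq (m≤m+n n _)) (<⇒≱ (Finₚ.toℕ<n j))
  value-injective {inj₂ i} {inj₂ j} eq =
    cong inj₂ (Finₚ.toℕ-injective (next-injective (Finₚ.toℕ<n i) (Finₚ.toℕ<n j) (+-cancelˡ-≡ n _ _ eq)))

  coupleSum≡odd : ∀ {x} → x < n → ∃ λ y → x + (n + next x) ≡ suc (2 * y)
  coupleSum≡odd {x} x<n with next-wraps x<n
  ... | inj₁ no-wrap = x + suc (suc q) , trans (cong (λ y → x + (n + y)) no-wrap) (solve 2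
          (λ x q → x :+ ((con 2 :+ con 2 :* (con 1 :+ q)) :+ (con 1 :+ x)) := con 1 :+ con 2 :* (x :+ (con 2 :+ q)))
          refl x q)
    where open +-*-Solver
  ... | inj₂ wrap    = x , (begin
    x + (n + next x)  ≡⟨ cong (x +_) (trans (+-comm n (next x)) wrap) ⟩
    x + suc x         ≡⟨ +-suc x x ⟩
    suc (x + x)       ≡⟨ cong suc (2*n≡n+n x) ⟨
    suc (2 * x)       ∎)
    where open ≡-Reasoning

  coupleSum-odd : ∀ a → (value a + value (swap a)) % 2 ≡ 1
  coupleSum-odd (inj₁ i) = let y , sum≡ = coupleSum≡odd (Finₚ.toℕ<n i) in
    trans (cong (_% 2) sum≡) (suc-double-odd y)
  coupleSum-odd (inj₂ i) = let y , sum≡ = coupleSum≡odd (Finₚ.toℕ<n i) in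
    trans (cong (_% 2) (trans (+-comm (n + next (toℕ i)) (toℕ i)) sum≡)) (suc-double-odd y)

  antipodal : ∀ {a a′} → value a ≡ value a′ + n →
    (value a + value (swap a)) % (2 * n) ≢ (value a′ + value (swap a′)) % (2 * n)
  antipodal {inj₁ i} {a′} shifted _ =
    <⇒≢+ (Finₚ.toℕ<n i) shifted
  antipodal {inj₂ i} {inj₂ j} shifted _ =
    <⇒≢+ (next< (toℕ i)) (+-cancelˡ-≡ n _ _ (trans shifted (+-assoc n _ n)))
  antipodal {inj₂ i} {inj₁ j} shifted eq = next²≢id (Finₚ.toℕ<n i) (sym (+-cancelˡ-% (2 * n)
    (value< (inj₂ i)) (value< (inj₁ i)) (<-≤-trans (next< (next x)) (m≤m+n n _)) (trans eq (cong (_% (2 * n)) (begin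
      toℕ j + (n + next (toℕ j))    ≡⟨ cong (λ y → y + (n + next y)) j≡next ⟨
      next x + (n + next (next x))  ≡⟨ +-assoc (next x) n _ ⟨
      next x + n + next (next x)    ≡⟨ cong (_+ next (next x)) (+-comm (next x) n) ⟩
      n + next x + next (next x)    ∎)))))
    where
    open ≡-Reasoning
    x : ℕ
    x = toℕ i
    j≡next : next x ≡ toℕ j
    j≡next = +-cancelˡ-≡ n _ _ (trans shifted (+-comm (toℕ j) n))

-- The case n = 2

module _ {n : ℕ} where

  allLabels? : {P : Label n → Set} → (∀ a → Dec (P a)) → Dec (∀ a → P a)
  allLabels? P? = map′ (λ (left , right) → λ { (inj₁ i) → left i ; (inj₂ i) → right i })
                       (λ all → all ∘ inj₁ , all ∘ inj₂)
                       (Finₚ.all? (P? ∘ inj₁) ×-dec Finₚ.all? (P? ∘ inj₂))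

  anyLabel? : {P : Label n → Set} → (∀ a → Dec (P a)) → Dec (∃ P)
  anyLabel? P? = map′ (λ { (inj₁ (i , p)) → inj₁ i , p ; (inj₂ (i , p)) → inj₂ i , p })
                      (λ { (inj₁ i , p) → inj₁ (i , p) ; (inj₂ i , p) → inj₂ (i , p) })
                      (Finₚ.any? (P? ∘ inj₁) ⊎-dec Finₚ.any? (P? ∘ inj₂))

  _≟ᴸ_ : (a b : Label n) → Dec (a ≡ b)
  _≟ᴸ_ = Sumₚ.≡-dec Finₚ._≟_ Finₚ._≟_

  module _ {m : ℕ} (u : Maybe (Fin n)) (colour : Label n → Label n → Fin m) where

    private
      cocktailParty? : ∀ a b → Dec (CocktailParty u a b)
      cocktailParty? a b = ¬? (a ≟ᴸ b) ×-dec ¬? (b ≟ᴸ swap a ×-dec coupled? u a)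

      hasColour? : ∀ a i → Dec (HasColour (CocktailParty u) colour a i)
      hasColour? a i = anyLabel? λ b → cocktailParty? a b ×-dec colour a b Finₚ.≟ i

      symmetric? = allLabels? λ a → allLabels? λ b → cocktailParty? a b →-dec colour a b Finₚ.≟ colour b a

      proper? = allLabels? λ a → allLabels? λ b → allLabels? λ b′ →
        cocktailParty? a b →-dec cocktailParty? a b′ →-dec ¬? (b ≟ᴸ b′) →-dec
        ¬? (colour a b Finₚ.≟ colour a b′)

      separating? = allLabels? λ a → allLabels? λ a′ → ¬? (a ≟ᴸ a′) →-dec Finₚ.any? λ i →
        (hasColour? a i ×-dec ¬? (hasColour? a′ i)) ⊎-dec (¬? (hasColour? a i) ×-dec hasColour? a′ i)

    checkedColouring : True (symmetric? ×-dec proper? ×-dec separating?) → SeparatingColouring (CocktailParty u) m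
    checkedColouring valid = let symmetric , proper , separating = toWitness valid in record
      { colour     = colour
      ; colour-sym = λ {a} {b} → symmetric a b
      ; proper     = λ {a} {b} {b′} → proper a b b′
      ; separating = λ {a} {a′} → separating a a′
      }

pattern A  = inj₁ zero
pattern B  = inj₁ (suc zero)
pattern A′ = inj₂ zero
pattern B′ = inj₂ (suc zero)

-- For n = 2 no sum colouring works: labels x and x + 2 have the same loop colour 2x and,
-- for either perfect matching of opposite parities, the same couple colour.
cocktailParty₂-colouring : (u : Maybe (Fin 2)) → SeparatingColouring (CocktailParty u) 4
cocktailParty₂-colouring nothing = checkedColouring nothing colour _
  where
  colour : Label 2 → Label 2 → Fin 4
  colour A  B  = # 0
  colour B  A  = # 0
  colour B  A′ = # 1
  colour A′ B  = # 1
  colour A′ B′ = # 2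
  colour B′ A′ = # 2
  colour B′ A  = # 3
  colour A  B′ = # 3
  colour _  _  = # 0
cocktailParty₂-colouring (just zero) = checkedColouring (just zero) colour _
  where
  colour : Label 2 → Label 2 → Fin 4
  colour A  B  = # 0
  colour B  A  = # 0
  colour B  A′ = # 1
  colour A′ B  = # 1
  colour A  B′ = # 1
  colour B′ A  = # 1
  colour A′ B′ = # 2
  colour B′ A′ = # 2
  colour A  A′ = # 3
  colour A′ A  = # 3
  colour _  _  = # 0
cocktailParty₂-colouring (just (suc zero)) = checkedColouring (just (suc zero)) colour _
  where
  colour : Label 2 → Label 2 → Fin 4
  colour A  B  = # 0
  colour B  A  = # 0
  colour A  B′ = # 1
  colour B′ A  = # 1
  colour A′ B  = # 1
  colour B  A′ = # 1
  colour A′ B′ = # 2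
  colour B′ A′ = # 2
  colour B  B′ = # 3
  colour B′ B  = # 3
  colour _  _  = # 0

oddOrEven : ∀ {n} → 3 ≤ n → (∃ λ q → n ≡ suc (2 * suc q)) ⊎ (∃ λ q → n ≡ suc (suc (2 * suc q)))
oddOrEven {1} (s≤s ())
oddOrEven {2} (s≤s (s≤s ()))
oddOrEven {3} _ = inj₁ (0 , refl)
oddOrEven {4} _ = inj₂ (0 , refl)
oddOrEven {suc (suc (suc (suc (suc n))))} _ with oddOrEven {3 + n} (s≤s (s≤s (s≤s z≤n)))
... | inj₁ (q , eq) = inj₁ (suc q , trans (cong (2 +_) eq) (cong suc (sym (*-suc 2 (suc q)))))
... | inj₂ (q , eq) = inj₂ (suc q , trans (cong (2 +_) eq) (cong (2 +_) (sym (*-suc 2 (suc q)))))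

cocktailPartyColouring : ∀ n → 2 ≤ n → (u : Maybe (Fin n)) → SeparatingColouring (CocktailParty u) (2 * n)
cocktailPartyColouring n 2≤n u with m≤n⇒m<n∨m≡n 2≤n
... | inj₂ refl = cocktailParty₂-colouring u
... | inj₁ 3≤n with oddOrEven 3≤n
...   | inj₁ (q , refl) = SumColouring.sumColouring (oddSumLabelling q) u
...   | inj₂ (q , refl) = SumColouring.sumColouring (evenSumLabelling q) u

theorem11 : (n k : ℕ) → 2 ≤ n → (k ≡ n ∸ 1 ⊎ k ≡ n) → (M : Matching (2 * n) k) →
    EdgeLocatingChromaticIndex (KminusM M) (2 * n)
theorem11 1 _ (s≤s ()) _ _
theorem11 n@(suc (suc _)) k 2≤n (inj₂ refl) M =
  edgeLocatingChromaticIndex-viaPalettes M 3≤2n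
    (Labelling.transferColouring (perfectLabelling M ≤-refl) (cocktailPartyColouring n 2≤n nothing))
    λ c separate → allMatched⇒lowerBound M c separate (perfect⇒allMatched M ≤-refl)
  where
  3≤2n : 3 ≤ 2 * n
  3≤2n = ≤-trans (n≤1+n 3) (*-monoʳ-≤ 2 2≤n)
theorem11 n@(suc (suc k)) (suc k) 2≤n (inj₁ refl) M
  with u , w , u≢w , ∉u , ∉w ← nearPerfect⇒twoUncovered M ≤-refl =
  edgeLocatingChromaticIndex-viaPalettes M 3≤2n
    (Labelling.transferColouring (nearPerfectLabelling M u≢w ∉u ∉w ≤-refl)
       (cocktailPartyColouring n 2≤n (just zero)))
    λ c separate →
      twoUnmatched⇒lowerBound M c separate u≢w (uncovered⇒unmatched M ∉u) (uncovered⇒unmatched M ∉w)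
  where
  3≤2n : 3 ≤ 2 * n
  3≤2n = ≤-trans (n≤1+n 3) (*-monoʳ-≤ 2 2≤n)
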